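{- Deterministically, the total cost of all induced-heavy levels is at most $O(1)$ times the total cost of all original-heavy and final-heavy levels.
   Context: Setting: $G=(V,E)$ is a dynamic graph on a fixed set $V$ of $n$ vertices that starts with no edges and undergoes a sequence of updates, each the insertion or deletion of one edge. A fixed integer $\Delta>0$ upper-bounds the maximum degree of $G$ at all times, and $\mathcal{C}=\{1,\dots,\Delta+1\}$ is the set of colors. Let $L=\lceil\log_3(n-1)\rceil-1$. The algorithm maintains a coloring $\chi:V\to\mathcal{C}$ and a level $\ell(v)\in\{ -1,0,\dots,L\}$ for each vertex $v$. For an edge $uv$, $u$ is an up-neighbor of $v$ if $\ell(u)\ge\ell(v)$ and a down-neighbor of $v$ if $\ell(u)<\ell(v)$. For a level $k$, $\phi_v(k)$ is the number of neighbors $u$ of $v$ with $\ell(u)<k$. A color $c$ is blank for $v$ if no neighbor of $v$ has color $c$, and unique for $v$ if no up-neighbor of $v$ has color $c$ and exactly one down-neighbor of $v$ has color $c$. Algorithm: initially every vertex is at level $-1$ with an arbitrary color. A deletion changes nothing. On insertion of an edge $uv$: if $\chi(u)\neq\chi(v)$ nothing changes; otherwise let $x$ be the endpoint among $u,v$ that was recolored most recently, and repeat $x\leftarrow\texttt{recolor}(x)$ until $x=\mathrm{NULL}$. The procedure $\texttt{recolor}(x)$: if $\phi_x(\ell(x)+1)<3^{\ell(x)+2}$, call $\texttt{det-color}(x)$, which assigns to $x$ a deterministically chosen blank color, sets $\ell(x)=-1$, and then return NULL. Otherwise call $\texttt{rand-color}(x)$, which: lets $\ell'$ be the minimum level $\ell'>\ell(x)$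 with $\phi_x(\ell'+1)<3^{\ell'+2}$ and sets $\ell(x)=\ell'$; picks uniformly at random a color $c$ among the colors that are blank or unique for $x$ and sets $\chi(x)=c$; returns NULL if $c$ is blank for $x$, and otherwise returns the unique down-neighbor $y$ of $x$ with $\chi(y)=c$. The implementation is such that $\texttt{det-color}(x)$ takes $O(3^{\ell(x)})$ time ($\ell(x)$ the level at the start of the call) and $\texttt{rand-color}(x)$ takes $O(3^{\ell'})$ time ($\ell'$ the new level). Epochs: an epoch $\mathcal{E}$ of a vertex $v=v(\mathcal{E})$ is a maximal time interval during which $v$ keeps the same color; it starts with a call to $\texttt{recolor}(v)$ and ends immediately before the next call to $\texttt{recolor}(v)$, if any. Its level $\ell(\mathcal{E})$ is the (constant) level of $v$ during $\mathcal{E}$, and $\mathcal{E}_\ell$ denotes the set of epochs at level $\ell$. An epoch is final if it is not ended by a call to $\texttt{recolor}(v)$. A non-final epoch is original if the call $\texttt{recolor}(v)$ ending it is triggered by the insertion of an edge $uv$ with $\chi(u)=\chi(v)$, and induced if that call is made because $\texttt{rand-color}(w)$ for some up-neighbor $w$ of $v$ returned $v$. The cost $c(\mathcal{E})$ of an epoch is the running time of the call to $\texttt{recolor}(v(\mathcal{E}))$ that starts it, where in addition the cost of every epoch at level $-1$ is reassigned to the previous epoch of the same vertex; with this convention $c(\mathcal{E})=O(3^{\ell(\mathcal{E})})$. The cost of a level $\ell$ is the total cost of the epochs in $\mathcal{E}_\ell$. A level $\ell$ is induced-heavy if at least a $1/2$-fraction of the epochs in $\mathcal{E}_\ell$ are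 induced; final-heavy if it is not induced-heavy and at least a $1/8$-fraction of the epochs in $\mathcal{E}_\ell$ are final; original-heavy if it is neither induced-heavy nor final-heavy. -}

module Defs where

open import Data.Nat using (ℕ; zero; suc; _+_; _*_; _^_; _≤_; _<ᵇ_; _≤ᵇ_; _≡ᵇ_; _%_)
open import Data.Bool using (Bool; true; false; _∧_; _∨_; not; if_then_else_)
open import Data.Fin using (Fin; zero; suc)
open import Data.Fin.Properties using () renaming (_≟_ to _≟F_)
open import Data.List using (List; []; _∷_; length; filterᵇ; allFin; map)
open import Data.Nat.ListAction using (sum)
open import Data.Maybe using (Maybe; just; nothing)
open import Data.Product using (_×_; _,_)
open import Relation.Nullary using (¬_)
open import Relation.Nullary.Decidable using (⌊_⌋)
open import Relation.Binary.PropositionalEquality using (_≡_)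

eqF : ∀ {n} → Fin n → Fin n → Bool
eqF u v = ⌊ u ≟F v ⌋

countF : ∀ {n} → (Fin n → Bool) → ℕ
countF {zero}  p = 0
countF {suc n} p = (if p zero then 1 else 0) + countF (λ i → p (suc i))

findF : ∀ {n} → (Fin n → Bool) → Maybe (Fin n)
findF {zero}  p = nothing
findF {suc n} p with p zero
... | true  = just zero
... | false with findF (λ i → p (suc i))
...   | just i  = just (suc i)
...   | nothing = nothing

setF : ∀ {n} {A : Set} → Fin n → A → (Fin n → A) → Fin n → A
setF x a f y = if eqF y x then a else f y

nth : {A : Set} → List A → ℕ → Maybe A
nth []       _       = nothing
nth (x ∷ xs) zero    = just x
nth (x ∷ xs) (suc k) = nth xs k

pick : {A : Set} → List A → ℕ → Maybe A
pick []       k = nothing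
pick (x ∷ xs) k = nth (x ∷ xs) (k % suc (length xs))

firstFrom : (ℕ → Bool) → ℕ → ℕ → ℕ
firstFrom p m zero       = m
firstFrom p m (suc fuel) = if p m then m else firstFrom p (suc m) fuel

Adj : ℕ → Set
Adj n = Fin n → Fin n → Bool

emptyG : ∀ {n} → Adj n
emptyG _ _ = false

isUV : ∀ {n} → Fin n → Fin n → Fin n → Fin n → Bool
isUV u v a b = (eqF a u ∧ eqF b v) ∨ (eqF a v ∧ eqF b u)

addE : ∀ {n} → Adj n → Fin n → Fin n → Adj n
addE g u v a b = isUV u v a b ∨ g a b

delE : ∀ {n} → Adj n → Fin n → Fin n → Adj n
delE g u v a b = not (isUV u v a b) ∧ g a b

deg : ∀ {n} → Adj n → Fin n → ℕ
deg g v = countF (g v)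

data Update (n : ℕ) : Set where
  ins : Fin n → Fin n → Update n
  del : Fin n → Fin n → Update n

data Valid {n : ℕ} (Δ : ℕ) : Adj n → List (Update n) → Set where
  done : ∀ {g} → Valid Δ g []
  vins : ∀ {g u v us} → ¬ (u ≡ v) → g u v ≡ false →
         (∀ w → deg (addE g u v) w ≤ Δ) →
         Valid Δ (addE g u v) us → Valid Δ g (ins u v ∷ us)
  vdel : ∀ {g u v us} → g u v ≡ true →
         Valid Δ (delE g u v) us → Valid Δ g (del u v ∷ us)

-- Algorithm state.  Levels are stored SHIFTED by one:
-- lev v = ℓ(v) + 1 ∈ {0,…,L+1}, so level -1 is stored as 0.
-- Colours {1,…,Δ+1} are Fin (suc Δ).

data EndKind : Set where
  original induced : EndKind

record Epoch (n : ℕ) : Set where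
  constructor epoch
  field
    vtx   : Fin n
    lvl   : ℕ              -- shifted level ℓ(E)+1
    cost  : ℕ              -- cost c(E) (after the level -1 reassignment)
    ended : Maybe EndKind  -- nothing = final epoch
open Epoch public

record State (n Δ : ℕ) : Set where
  constructor mkState
  field
    adj   : Adj n
    col   : Fin n → Fin (suc Δ)
    lev   : Fin n → ℕ
    last  : Fin n → ℕ        -- time of the last recolor call (0 = never)
    clock : ℕ                -- index of the next recolor call (starts at 1)
    epochs : List (Epoch n)  -- all epochs so far, newest first
open State public

-- The random choices of rand-color and the choices of det-color are
-- given by arbitrary oracles (indexed by the recolor call number).
record Oracle : Set where
  field
    rnd : ℕ → ℕ
    det : ℕ → ℕ
open Oracle public

initState : ∀ {n Δ} → (Fin n → Fin (suc Δ)) → State n Δ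
initState c0 = mkState emptyG c0 (λ _ → 0) (λ _ → 0) 1 []

closeEpoch : ∀ {n} → Fin n → EndKind → ℕ → List (Epoch n) → List (Epoch n)
closeEpoch x k extra [] = []
closeEpoch x k extra (e ∷ es) =
  if eqF (vtx e) x
  then epoch (vtx e) (lvl e) (cost e + extra) (just k) ∷ es
  else e ∷ closeEpoch x k extra es

allColors : ∀ {Δ} → List (Fin (suc Δ))
allColors {Δ} = allFin (suc Δ)

nbCol : ∀ {n Δ} → State n Δ → Fin n → (ℕ → Bool) → Fin (suc Δ) → ℕ
nbCol s x q c = countF (λ u → adj s x u ∧ q (lev s u) ∧ eqF (col s u) c)

-- φ_x(k) with shifted argument K = k + 1 : neighbours u with ℓ(u) < k
phi : ∀ {n Δ} → State n Δ → Fin n → ℕ → ℕ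
phi s x K = countF (λ u → adj s x u ∧ (lev s u <ᵇ K))

-- for shifted level m (ℓ = m - 1):  φ_x(ℓ+1) < 3^(ℓ+2)
goodLevel : ∀ {n Δ} → State n Δ → Fin n → ℕ → Bool
goodLevel s x m = phi s x (suc m) <ᵇ 3 ^ suc m

-- Returns the new state and the next vertex (nothing = NULL).
-- Running times (scaled by 3): det-color from level ℓ costs 3^(ℓ+1),
-- rand-color to level ℓ' costs 3^(ℓ'+1).
recolor : ∀ {n Δ} → Oracle → State n Δ → Fin n → EndKind → State n Δ × Maybe (Fin n)
recolor {n} {Δ} o s x k =
  if goodLevel s x lx then detBranch else randBranch
  where
  t  = clock s
  lx = lev s x

  finish : Fin (suc Δ) → ℕ → ℕ → State n Δ
  finish c newl cst =
    mkState (adj s) (setF x c (col s)) (setF x newl (lev s))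
            (setF x t (last s)) (suc t)
            (epoch x newl (if newl ≡ᵇ 0 then 0 else cst) nothing
              ∷ closeEpoch x k (if newl ≡ᵇ 0 then cst else 0) (epochs s))

  orDefault : Maybe (Fin (suc Δ)) → Fin (suc Δ)
  orDefault (just c) = c
  orDefault nothing  = col s x

  blankD : Fin (suc Δ) → Bool
  blankD c = nbCol s x (λ _ → true) c ≡ᵇ 0
  cD = orDefault (pick (filterᵇ blankD allColors) (det o t))
  detBranch = finish cD 0 (3 ^ lx) , nothing

  m  = firstFrom (goodLevel s x) (suc lx) (suc n)
  up   = nbCol s x (λ l → m ≤ᵇ l)
  down = nbCol s x (λ l → l <ᵇ m)
  blankR : Fin (suc Δ) → Bool
  blankR c = (up c + down c) ≡ᵇ 0
  uniqR : Fin (suc Δ) → Bool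
  uniqR c = (up c ≡ᵇ 0) ∧ (down c ≡ᵇ 1)
  cR = orDefault (pick (filterᵇ (λ c → blankR c ∨ uniqR c) allColors) (rnd o t))
  nextV : Maybe (Fin n)
  nextV = if blankR cR then nothing
          else findF (λ u → adj s x u ∧ (lev s u <ᵇ m) ∧ eqF (col s u) cR)
  randBranch = finish cR m (3 ^ m) , nextV

-- repeat x ← recolor(x) until NULL (with fuel; nothing = fuel exhausted)
cascade : ∀ {n Δ} → Oracle → ℕ → State n Δ → Fin n → EndKind → Maybe (State n Δ)
cascade o zero     s x k = nothing
cascade o (suc f) s x k with recolor o s x k
... | s' , nothing = just s'
... | s' , just y  = cascade o f s' y induced

withAdj : ∀ {n Δ} → State n Δ → Adj n → State n Δ
withAdj s g = mkState g (col s) (lev s) (last s) (clock s) (epochs s)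

step : ∀ {n Δ} → Oracle → ℕ → State n Δ → Update n → Maybe (State n Δ)
step o f s (del u v) = just (withAdj s (delE (adj s) u v))
step o f s (ins u v) =
  if eqF (col s u) (col s v)
  then cascade o f s1 (if last s u <ᵇ last s v then v else u) original
  else just s1
  where s1 = withAdj s (addE (adj s) u v)

run : ∀ {n Δ} → Oracle → ℕ → State n Δ → List (Update n) → Maybe (State n Δ)
run o f s [] = just s
run o f s (x ∷ us) with step o f s x
... | nothing = nothing
... | just s' = run o f s' us

countE : ∀ {n} → (Epoch n → Bool) → List (Epoch n) → ℕ
countE p es = length (filterᵇ p es)

isInduced : ∀ {n} → Epoch n → Bool
isInduced e with ended e
... | just induced = true
... | _            = false

isFinal : ∀ {n} → Epoch n → Bool
isFinal e with ended e
... | nothing = true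
... | just _  = false

atLevel : ∀ {n} → ℕ → Epoch n → Bool
atLevel m e = lvl e ≡ᵇ m

inducedHeavy : ∀ {n} → List (Epoch n) → ℕ → Bool
inducedHeavy es m =
  countE (atLevel m) es ≤ᵇ 2 * countE (λ e → atLevel m e ∧ isInduced e) es

finalHeavy : ∀ {n} → List (Epoch n) → ℕ → Bool
finalHeavy es m = not (inducedHeavy es m) ∧
  (countE (atLevel m) es ≤ᵇ 8 * countE (λ e → atLevel m e ∧ isFinal e) es)

originalHeavy : ∀ {n} → List (Epoch n) → ℕ → Bool
originalHeavy es m = not (inducedHeavy es m) ∧ not (finalHeavy es m)

costOfLevels : ∀ {n} → List (Epoch n) → (ℕ → Bool) → ℕ
costOfLevels es p = sum (map cost (filterᵇ (λ e → p (lvl e)) es))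

module Submission where

-- Weigh every epoch E by 3^lvl(E), where lvl = ℓ + 1 is the stored level;
-- this is the (scaled) running time of rand-color to level ℓ.
-- Charging argument: an induced epoch at stored level L is ended by
-- rand-color of an up-neighbour that at the same moment starts an epoch at a
-- stored level m > L, so three times its weight, 3^(L+1) ≤ 3^m, is covered
-- by the weight of that new epoch, and each new epoch covers at most one
-- induced epoch.  With the cost bounds  3^lvl ≤ c(E) ≤ 2·3^lvl  (the lower
-- bound for epochs started by rand-color) this forms an invariant
-- (`Invariant`), proved for one call of recolor (`Recolored`), for
-- cascades, updates and whole runs.
-- Counting argument (`heavy-levels-bound`): on induced-heavy levels at least
-- half of the epochs are induced, so, level by level (`levelwise-bound`),
-- their weight W is at most twice the weight of their induced epochs, which
-- the invariant bounds by (W + N)/3, N the cost of the other levels; hence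
-- W ≤ 2N and the induced-heavy levels cost at most 2W ≤ 4N.

open import Defs
open import Data.Bool using (Bool; true; false; not; _∧_; _∨_; T; if_then_else_)
open import Data.Bool.Properties using (∧-identityʳ; ∧-zeroʳ; T-∧; T-≡)
open import Data.Fin as Fin using (Fin)
open import Data.Fin.Properties using () renaming (_≟_ to _≟F_)
open import Data.List using (List; []; _∷_; map; filterᵇ; length)
open import Data.List.Extrema.Nat using (max; xs≤max)
open import Data.List.Relation.Unary.All as All using (All; []; _∷_)
import Data.List.Relation.Unary.All.Properties as All
open import Data.Maybe using (Maybe; just; nothing)
open import Data.Maybe.Relation.Unary.All as Maybe using (just; nothing)
open import Data.Nat using (ℕ; zero; suc; _+_; _*_; _^_; _≤_; _<_; _≤ᵇ_; _<ᵇ_; _≡ᵇ_; z≤n; s≤s)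
open import Data.Nat.ListAction using (sum)
open import Data.Nat.Properties
import Algebra.Properties.CommutativeSemigroup as CommSemigroupProperties
open CommSemigroupProperties +-commutativeSemigroup using () renaming (x∙yz≈y∙xz to +-exchange)
open CommSemigroupProperties *-commutativeSemigroup using () renaming (x∙yz≈y∙xz to *-exchange)
open import Data.Product using (∃-syntax; _×_; _,_; proj₁; proj₂)
open import Function using (_∘_; Equivalence)
open import Relation.Binary.PropositionalEquality
open import Relation.Nullary using (yes; no; contradiction)

module _ {A : Set} where

  sumWhere : (A → Bool) → (A → ℕ) → List A → ℕ
  sumWhere p g xs = sum (map g (filterᵇ p xs))

  count : (A → Bool) → List A → ℕ
  count p xs = length (filterᵇ p xs)

  filterᵇ-cong : ∀ {p p' : A → Bool} {xs} → All (λ x → p x ≡ p' x) xs → filterᵇ p xs ≡ filterᵇ p' xs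
  filterᵇ-cong [] = refl
  filterᵇ-cong {p} {p'} {x ∷ xs} (px ∷ pxs) with p x | p' x | px
  ... | true  | .true  | refl = cong (x ∷_) (filterᵇ-cong pxs)
  ... | false | .false | refl = filterᵇ-cong pxs

  sumWhere-cong : ∀ {p p' : A → Bool} g xs → All (λ x → p x ≡ p' x) xs → sumWhere p g xs ≡ sumWhere p' g xs
  sumWhere-cong g xs eqs = cong (sum ∘ map g) (filterᵇ-cong eqs)

  count-cong : ∀ {p p' : A → Bool} xs → (∀ x → p x ≡ p' x) → count p xs ≡ count p' xs
  count-cong xs eqs = cong length (filterᵇ-cong (All.universal eqs xs))

  sumWhere-split : ∀ (p r : A → Bool) g xs →
    sumWhere p g xs ≡ sumWhere (λ x → p x ∧ r x) g xs + sumWhere (λ x → p x ∧ not (r x)) g xs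
  sumWhere-split p r g [] = refl
  sumWhere-split p r g (x ∷ xs) with p x | r x
  ... | false | _     = sumWhere-split p r g xs
  ... | true  | true  = trans (cong (g x +_) (sumWhere-split p r g xs)) (sym (+-assoc (g x) _ _))
  ... | true  | false = trans (cong (g x +_) (sumWhere-split p r g xs))
                              (+-exchange (g x) (sumWhere (λ x → p x ∧ r x) g xs) _)

  sumWhere-monoˡ : ∀ {p p' : A → Bool} g xs → (∀ x → T (p x) → T (p' x)) →
    sumWhere p g xs ≤ sumWhere p' g xs
  sumWhere-monoˡ g [] p⇒p' = z≤n
  sumWhere-monoˡ {p} {p'} g (x ∷ xs) p⇒p' with p x | p' x | p⇒p' x
  ... | true  | true  | _ = +-monoʳ-≤ (g x) (sumWhere-monoˡ g xs p⇒p')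
  ... | true  | false | h with () ← h _
  ... | false | true  | _ = ≤-trans (sumWhere-monoˡ g xs p⇒p') (m≤n+m _ (g x))
  ... | false | false | _ = sumWhere-monoˡ g xs p⇒p'

  sumWhere-monoʳ : ∀ {p : A → Bool} (g g' : A → ℕ) xs → All (λ x → T (p x) → g x ≤ g' x) xs →
    sumWhere p g xs ≤ sumWhere p g' xs
  sumWhere-monoʳ g g' [] [] = z≤n
  sumWhere-monoʳ {p} g g' (x ∷ xs) (h ∷ hs) with p x
  ... | true  = +-mono-≤ (h _) (sumWhere-monoʳ g g' xs hs)
  ... | false = sumWhere-monoʳ g g' xs hs

  sumWhere-scale : ∀ (p : A → Bool) k g xs → sumWhere p (λ x → k * g x) xs ≡ k * sumWhere p g xs
  sumWhere-scale p k g [] = sym (*-zeroʳ k)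
  sumWhere-scale p k g (x ∷ xs) with p x
  ... | true  = trans (cong (k * g x +_) (sumWhere-scale p k g xs)) (sym (*-distribˡ-+ k (g x) _))
  ... | false = sumWhere-scale p k g xs

  sumWhere-const : ∀ (p : A → Bool) g c xs → (∀ x → T (p x) → g x ≡ c) → sumWhere p g xs ≡ c * count p xs
  sumWhere-const p g c [] h = sym (*-zeroʳ c)
  sumWhere-const p g c (x ∷ xs) h with p x | h x
  ... | true  | gx≡c = trans (cong₂ _+_ (gx≡c _) (sumWhere-const p g c xs h)) (sym (*-suc c _))
  ... | false | _    = sumWhere-const p g c xs h

≡ᵇ-subst : ∀ (f : ℕ → Bool) l m → (l ≡ᵇ m) ∧ f l ≡ (l ≡ᵇ m) ∧ f m
≡ᵇ-subst f l m with l ≡ᵇ m in l≡m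
... | false = refl
... | true  = cong f (≡ᵇ⇒≡ l m (subst T (sym l≡m) _))

<ᵇsuc-at : ∀ l M b → ((l <ᵇ suc M) ∧ b) ∧ (l ≡ᵇ M) ≡ (l ≡ᵇ M) ∧ b
<ᵇsuc-at zero    zero    b = ∧-identityʳ b
<ᵇsuc-at zero    (suc M) b = ∧-zeroʳ b
<ᵇsuc-at (suc l) zero    b = refl
<ᵇsuc-at (suc l) (suc M) b = <ᵇsuc-at l M b

<ᵇsuc-below : ∀ l M b → ((l <ᵇ suc M) ∧ b) ∧ not (l ≡ᵇ M) ≡ (l <ᵇ M) ∧ b
<ᵇsuc-below zero    zero    b = ∧-zeroʳ b
<ᵇsuc-below zero    (suc M) b = ∧-identityʳ b
<ᵇsuc-below (suc l) zero    b = refl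
<ᵇsuc-below (suc l) (suc M) b = <ᵇsuc-below l M b

module ByLevel {A : Set} (lv : A → ℕ) where

  at : ℕ → (A → Bool) → A → Bool
  at m P x = (lv x ≡ᵇ m) ∧ P x

  below : ℕ → (A → Bool) → A → Bool
  below M P x = (lv x <ᵇ M) ∧ P x

  below-zero : ∀ P g xs → sumWhere (below 0 P) g xs ≡ 0
  below-zero P g [] = refl
  below-zero P g (x ∷ xs) with lv x
  ... | zero  = below-zero P g xs
  ... | suc _ = below-zero P g xs

  below-suc : ∀ M P g xs → sumWhere (below (suc M) P) g xs ≡ sumWhere (below M P) g xs + sumWhere (at M P) g xs
  below-suc M P g xs = begin
    sumWhere (below (suc M) P) g xs
      ≡⟨ sumWhere-split (below (suc M) P) (λ x → lv x ≡ᵇ M) g xs ⟩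
    sumWhere (λ x → below (suc M) P x ∧ (lv x ≡ᵇ M)) g xs
      + sumWhere (λ x → below (suc M) P x ∧ not (lv x ≡ᵇ M)) g xs
      ≡⟨ cong₂ _+_ (sumWhere-cong g xs (All.universal (λ x → <ᵇsuc-at (lv x) M (P x)) xs))
                   (sumWhere-cong g xs (All.universal (λ x → <ᵇsuc-below (lv x) M (P x)) xs)) ⟩
    sumWhere (at M P) g xs + sumWhere (below M P) g xs
      ≡⟨ +-comm (sumWhere (at M P) g xs) _ ⟩
    sumWhere (below M P) g xs + sumWhere (at M P) g xs ∎
    where open ≡-Reasoning

  sum-at : ∀ m P (w : ℕ → ℕ) xs → sumWhere (at m P) (w ∘ lv) xs ≡ w m * count (at m P) xs
  sum-at m P w xs = sumWhere-const (at m P) (w ∘ lv) (w m) xs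
    λ x h → cong w (≡ᵇ⇒≡ (lv x) m (proj₁ (Equivalence.to T-∧ h)))

  levelwise-bound : ∀ (w : ℕ → ℕ) k (P Q : A → Bool) xs →
    (∀ m → count (at m P) xs ≤ k * count (at m Q) xs) →
    sumWhere P (w ∘ lv) xs ≤ k * sumWhere Q (w ∘ lv) xs
  levelwise-bound w k P Q xs per-level =
    subst₂ (λ a b → a ≤ k * b) (sumWhere-cong g xs (all-below P)) (sumWhere-cong g xs (all-below Q)) (bound-below M)
    where
    g = w ∘ lv
    M = suc (max 0 (map lv xs))
    all-below : ∀ R → All (λ x → below M R x ≡ R x) xs
    all-below R = All.map (λ {x} lv≤max → cong (_∧ R x) (Equivalence.to T-≡ (<⇒<ᵇ (s≤s lv≤max))))
                          (All.map⁻ (xs≤max 0 (map lv xs)))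
    bound-at : ∀ m → sumWhere (at m P) g xs ≤ k * sumWhere (at m Q) g xs
    bound-at m = begin
      sumWhere (at m P) g xs    ≡⟨ sum-at m P w xs ⟩
      w m * count (at m P) xs   ≤⟨ *-monoʳ-≤ (w m) (per-level m) ⟩
      w m * (k * count (at m Q) xs) ≡⟨ *-exchange (w m) k _ ⟩
      k * (w m * count (at m Q) xs) ≡⟨ cong (k *_) (sum-at m Q w xs) ⟨
      k * sumWhere (at m Q) g xs ∎
      where open ≤-Reasoning
    bound-below : ∀ M → sumWhere (below M P) g xs ≤ k * sumWhere (below M Q) g xs
    bound-below zero = ≤-trans (≤-reflexive (below-zero P g xs)) z≤n
    bound-below (suc M) = begin
      sumWhere (below (suc M) P) g xs ≡⟨ below-suc M P g xs ⟩
      sumWhere (below M P) g xs + sumWhere (at M P) g xs ≤⟨ +-mono-≤ (bound-below M) (bound-at M) ⟩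
      k * sumWhere (below M Q) g xs + k * sumWhere (at M Q) g xs ≡⟨ *-distribˡ-+ k _ _ ⟨
      k * (sumWhere (below M Q) g xs + sumWhere (at M Q) g xs) ≡⟨ cong (k *_) (below-suc M Q g xs) ⟨
      k * sumWhere (below (suc M) Q) g xs ∎
      where open ≤-Reasoning

weight : ∀ {n} → Epoch n → ℕ
weight e = 3 ^ lvl e

-- Three times the weight of each induced epoch: what has to be paid for.
inducedCharge : ∀ {n} → List (Epoch n) → ℕ
inducedCharge = sumWhere isInduced (λ e → 3 * weight e)

-- The weight of each epoch started by rand-color (shifted level ≥ 1).
randCredit : ∀ {n} → List (Epoch n) → ℕ
randCredit = sumWhere (λ e → 1 ≤ᵇ lvl e) weight

endCharge : EndKind → ℕ → ℕ
endCharge original l = 0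
endCharge induced  l = 3 * 3 ^ l

-- The newest epoch of x in the list is open and at level l; if x has no
-- epoch yet, then l = 0 (x is still at level -1).
data CurrentEpoch {n} (x : Fin n) : ℕ → List (Epoch n) → Set where
  none  : CurrentEpoch x 0 []
  here  : ∀ {l c es} → CurrentEpoch x l (epoch x l c nothing ∷ es)
  there : ∀ {l e es} → vtx e ≢ x → CurrentEpoch x l es → CurrentEpoch x l (e ∷ es)

close-credit : ∀ {n} (x : Fin n) k extra es → randCredit (closeEpoch x k extra es) ≡ randCredit es
close-credit x k extra [] = refl
close-credit x k extra (epoch v l c en ∷ es) with v ≟F x
... | yes _ with 1 ≤ᵇ l
...   | true  = refl
...   | false = refl
close-credit x k extra (epoch v l c en ∷ es) | no _ with 1 ≤ᵇ l
...   | true  = cong (3 ^ l +_) (close-credit x k extra es)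
...   | false = close-credit x k extra es

close-charge : ∀ {n} (x : Fin n) k extra {l} es → CurrentEpoch x l es →
  inducedCharge (closeEpoch x k extra es) ≤ inducedCharge es + endCharge k l
close-charge x k extra [] none = z≤n
close-charge x k extra (epoch .x l c .nothing ∷ es) here with x ≟F x
... | no x≢x = contradiction refl x≢x
close-charge x original extra (epoch .x l c .nothing ∷ es) here | yes _ = m≤m+n _ 0
close-charge x induced  extra (epoch .x l c .nothing ∷ es) here | yes _ = ≤-reflexive (+-comm (3 * 3 ^ l) _)
close-charge x k extra {l} (e ∷ es) (there e≢x cur) with vtx e ≟F x
... | yes e≡x = contradiction e≡x e≢x
... | no _ with isInduced e
...   | true  = ≤-trans (+-monoʳ-≤ (3 * weight e) (close-charge x k extra es cur))
                      (≤-reflexive (sym (+-assoc (3 * weight e) (inducedCharge es) (endCharge k l))))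
...   | false = close-charge x k extra es cur

-- Cost bounds of an epoch relative to its weight: at most twice the weight
-- (rand-color to its level plus det-color from it), at least the weight if
-- started by rand-color, and at most the weight while still open.
record CostBounds {n} (e : Epoch n) : Set where
  field
    cost≤2weight   : cost e ≤ 2 * weight e
    weight≤cost    : 1 ≤ lvl e → weight e ≤ cost e
    open⇒cost≤weight : ended e ≡ nothing → cost e ≤ weight e
open CostBounds

close-costs : ∀ {n} (x : Fin n) k extra {l} es → CurrentEpoch x l es → extra ≤ 3 ^ l →
  All CostBounds es → All CostBounds (closeEpoch x k extra es)
close-costs x k extra [] none _ [] = []
close-costs x k extra (epoch .x l c .nothing ∷ es) here extra≤ (b ∷ bs) with x ≟F x
... | no x≢x = contradiction refl x≢x
... | yes _ = record
  { cost≤2weight   = ≤-trans (+-mono-≤ (open⇒cost≤weight b refl) extra≤)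
                             (≤-reflexive (cong (3 ^ l +_) (sym (+-identityʳ (3 ^ l)))))
  ; weight≤cost    = λ 1≤l → ≤-trans (weight≤cost b 1≤l) (m≤m+n c extra)
  ; open⇒cost≤weight = λ ()
  } ∷ bs
close-costs x k extra (e ∷ es) (there e≢x cur) extra≤ (b ∷ bs) with vtx e ≟F x
... | yes e≡x = contradiction e≡x e≢x
... | no _    = b ∷ close-costs x k extra es cur extra≤ bs

close-current : ∀ {n} (x y : Fin n) k extra {l} es → y ≢ x → CurrentEpoch y l es →
  CurrentEpoch y l (closeEpoch x k extra es)
close-current x y k extra [] y≢x none = none
close-current x y k extra (epoch .y l c .nothing ∷ es) y≢x here with y ≟F x
... | yes y≡x = contradiction y≡x y≢x
... | no _    = here
close-current x y k extra (e ∷ es) y≢x (there e≢y cur) with vtx e ≟F x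
... | yes _ = there e≢y cur
... | no _  = there e≢y (close-current x y k extra es y≢x cur)

if-elim : ∀ {A : Set} (P : A → Set) b {a a'} → P a → P a' → P (if b then a else a')
if-elim P true  pa pa' = pa
if-elim P false pa pa' = pa'

findF-sound : ∀ {n} (p : Fin n → Bool) → Maybe.All (T ∘ p) (findF p)
findF-sound {zero}  p = nothing
findF-sound {suc n} p with p Fin.zero in p0
... | true  = just (subst T (sym p0) _)
... | false with findF (λ i → p (Fin.suc i)) | findF-sound (λ i → p (Fin.suc i))
...   | just i  | just pi = just pi
...   | nothing | nothing = nothing

firstFrom-≥ : ∀ p start fuel → start ≤ firstFrom p start fuel
firstFrom-≥ p start zero = ≤-refl
firstFrom-≥ p start (suc fuel) with p start
... | true  = ≤-refl
... | false = ≤-trans (n≤1+n start) (firstFrom-≥ p (suc start) fuel)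

NextVertex : ∀ {n Δ} → State n Δ → Fin n → ℕ → Maybe (Fin n) → Set
NextVertex s x m = Maybe.All (λ y → T (adj s x y) × lev s y < m)

-- How a call recolor(x) ends: det-color moves x to level -1 (shifted 0) and
-- carries its running time 3^lev over to the epoch it ends; rand-color moves
-- x to a level m ≥ 1 and its epoch pays its own running time 3^m.
data Branch {n Δ} (s : State n Δ) (x : Fin n) : (m c carried : ℕ) → Maybe (Fin n) → Set where
  byDet  : Branch s x 0 0 (3 ^ lev s x) nothing
  byRand : ∀ {m next} → 1 ≤ m → NextVertex s x m next → Branch s x m (3 ^ m) 0 next

record Recolored {n Δ} (s : State n Δ) (x : Fin n) (k : EndKind) (result : State n Δ × Maybe (Fin n)) : Set where
  constructor recolored
  field
    newLevel startCost carried : ℕ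
    adj-kept    : adj (proj₁ result) ≡ adj s
    lev-updated : lev (proj₁ result) ≡ setF x newLevel (lev s)
    epochs-updated : epochs (proj₁ result) ≡ epoch x newLevel startCost nothing ∷ closeEpoch x k carried (epochs s)
    branch      : Branch s x newLevel startCost carried (proj₂ result)

recolor-spec : ∀ {n Δ} o (s : State n Δ) x k → Recolored s x k (recolor o s x k)
recolor-spec {n} o s x k =
  if-elim (Recolored s x k) (goodLevel s x (lev s x))
    (recolored _ _ _ refl refl refl byDet)
    (recolored m _ _ refl refl refl (rand-branch m 1≤m next-ok))
  where
  m = firstFrom (goodLevel s x) (suc (lev s x)) (suc n)
  1≤m : 1 ≤ m
  1≤m = ≤-trans (s≤s z≤n) (firstFrom-≥ (goodLevel s x) (suc (lev s x)) (suc n))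
  rand-branch : ∀ m {next} → 1 ≤ m → NextVertex s x m next →
    Branch s x m (if m ≡ᵇ 0 then 0 else 3 ^ m) (if m ≡ᵇ 0 then 3 ^ m else 0) next
  rand-branch (suc m) _ ok = byRand (s≤s z≤n) ok
  below-m : ∀ {q : Fin n → Bool} y → T (adj s x y ∧ (lev s y <ᵇ m) ∧ q y) → T (adj s x y) × lev s y < m
  below-m y h with adj-xy , rest ← Equivalence.to T-∧ h =
    adj-xy , <ᵇ⇒< (lev s y) m (proj₁ (Equivalence.to T-∧ rest))
  next-ok : ∀ {b} {q : Fin n → Bool} →
    NextVertex s x m (if b then nothing else findF (λ u → adj s x u ∧ (lev s u <ᵇ m) ∧ q u))
  next-ok {b} {q} = if-elim (NextVertex s x m) b nothing (Maybe.map (below-m {q} _) (findF-sound _))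

setF-other : ∀ {n} {A : Set} (x y : Fin n) (a : A) f → y ≢ x → setF x a f y ≡ f y
setF-other x y a f y≢x with y ≟F x
... | yes y≡x = contradiction y≡x y≢x
... | no _    = refl

-- The invariant maintained by the algorithm.  `pending` is the charge of the
-- epoch about to be ended by the next call of recolor (0 if none).
record Invariant {n Δ} (s : State n Δ) (pending : ℕ) : Set where
  field
    loopless : ∀ x → adj s x x ≡ false
    current  : ∀ x → CurrentEpoch x (lev s x) (epochs s)
    costs    : All CostBounds (epochs s)
    paid     : inducedCharge (epochs s) + pending ≤ randCredit (epochs s)
open Invariant

pendingCharge : ∀ {n Δ} → State n Δ → Maybe (Fin n) → ℕ
pendingCharge s nothing  = 0
pendingCharge s (just y) = endCharge induced (lev s y)

module _ {n Δ} {s s' : State n Δ} {x : Fin n} {k : EndKind} {next : Maybe (Fin n)}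
         (I : Invariant s (endCharge k (lev s x))) (spec : Recolored s x k (s' , next)) where
  open Recolored spec

  recolored-current : ∀ y → CurrentEpoch y (lev s' y) (epochs s')
  recolored-current y rewrite lev-updated | epochs-updated with y ≟F x
  ... | yes refl = here
  ... | no y≢x   =
    there (λ x≡y → y≢x (sym x≡y)) (close-current x y k carried (epochs s) y≢x (current I y))

  recolored-costs : All CostBounds (epochs s')
  recolored-costs rewrite epochs-updated with branch
  ... | byDet      = head ∷ close-costs x k _ (epochs s) (current I x) ≤-refl (costs I)
    where head = record { cost≤2weight = z≤n ; weight≤cost = λ () ; open⇒cost≤weight = λ _ → z≤n }
  ... | byRand _ _ = head ∷ close-costs x k 0 (epochs s) (current I x) z≤n (costs I)
    where head = record { cost≤2weight = m≤m+n _ _ ; weight≤cost = λ _ → ≤-refl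
                        ; open⇒cost≤weight = λ _ → ≤-refl }

  closed-paid : inducedCharge (closeEpoch x k carried (epochs s)) ≤ randCredit (closeEpoch x k carried (epochs s))
  closed-paid = begin
    inducedCharge (closeEpoch x k carried (epochs s)) ≤⟨ close-charge x k carried (epochs s) (current I x) ⟩
    inducedCharge (epochs s) + endCharge k (lev s x)  ≤⟨ paid I ⟩
    randCredit (epochs s)                             ≡⟨ close-credit x k carried (epochs s) ⟨
    randCredit (closeEpoch x k carried (epochs s))    ∎
    where open ≤-Reasoning

  -- The vertex handed on by rand-color is a neighbour, hence differs from x.
  next≢x : ∀ {y} → T (adj s x y) → y ≢ x
  next≢x adj-xy refl = subst T (loopless I x) adj-xy

  -- The new epoch of rand-color at level m adds credit 3^m, enough for the
  -- charge 3·3^lev y of the down-neighbour y it hands on.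
  recolored-paid : inducedCharge (epochs s') + pendingCharge s' next ≤ randCredit (epochs s')
  recolored-paid rewrite epochs-updated with branch
  ... | byDet = ≤-trans (≤-reflexive (+-identityʳ _)) closed-paid
  ... | byRand {suc m} _ nothing =
    ≤-trans (≤-reflexive (+-identityʳ _)) (≤-trans closed-paid (m≤n+m _ (3 ^ suc m)))
  ... | byRand {suc m} _ (just {y} (adj-xy , y<m)) = begin
    inducedCharge cl + 3 * 3 ^ lev s' y ≡⟨ cong (λ l → inducedCharge cl + 3 * 3 ^ l) lev-y ⟩
    inducedCharge cl + 3 * 3 ^ lev s y  ≤⟨ +-mono-≤ closed-paid (*-monoʳ-≤ 3 (^-monoʳ-≤ 3 (≤-pred y<m))) ⟩
    randCredit cl + 3 ^ suc m           ≡⟨ +-comm (randCredit cl) _ ⟩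
    3 ^ suc m + randCredit cl           ∎
    where
    open ≤-Reasoning
    cl = closeEpoch x k carried (epochs s)
    lev-y : lev s' y ≡ lev s y
    lev-y = trans (cong (λ f → f y) lev-updated) (setF-other x y (suc m) (lev s) (next≢x adj-xy))

  recolor-invariant : Invariant s' (pendingCharge s' next)
  recolor-invariant = record
    { loopless = λ z → trans (cong (λ g → g z z) adj-kept) (loopless I z)
    ; current  = recolored-current
    ; costs    = recolored-costs
    ; paid     = recolored-paid
    }

cascade-invariant : ∀ {n Δ} o fuel (s : State n Δ) x k {s''} → Invariant s (endCharge k (lev s x)) →
  cascade o fuel s x k ≡ just s'' → Invariant s'' 0
cascade-invariant o (suc fuel) s x k I eq with recolor o s x k | recolor-spec o s x k
cascade-invariant o (suc fuel) s x k I refl | s' , nothing | spec = recolor-invariant I spec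
... | s' , just y | spec = cascade-invariant o fuel s' y induced (recolor-invariant I spec) eq

withAdj-invariant : ∀ {n Δ} (s : State n Δ) g → (∀ z → g z z ≡ false) → Invariant s 0 →
  Invariant (withAdj s g) 0
withAdj-invariant s g loopless-g I =
  record { loopless = loopless-g ; current = current I ; costs = costs I ; paid = paid I }

insert-loopless : ∀ {n} (g : Adj n) u v → u ≢ v → (∀ z → g z z ≡ false) → ∀ z → addE g u v z z ≡ false
insert-loopless g u v u≢v loopless-g z with z ≟F u | z ≟F v
... | yes refl | yes refl = contradiction refl u≢v
... | yes refl | no _     = loopless-g z
... | no _     | yes refl = loopless-g z
... | no _     | no _     = loopless-g z

delete-loopless : ∀ {n} (g : Adj n) u v → (∀ z → g z z ≡ false) → ∀ z → delE g u v z z ≡ false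
delete-loopless g u v loopless-g z = trans (cong (not (isUV u v z z) ∧_) (loopless-g z)) (∧-zeroʳ _)

-- An insertion either changes only the graph or starts a cascade whose first
-- call ends an epoch originally, at no charge.
insert-invariant : ∀ {n Δ} o fuel (s : State n Δ) u v {s'} → u ≢ v → Invariant s 0 →
  step o fuel s (ins u v) ≡ just s' → Invariant s' 0
insert-invariant o fuel s u v u≢v I =
  if-elim (λ r → r ≡ just _ → Invariant _ 0) (eqF (col s u) (col s v))
    (cascade-invariant o fuel s₁ _ original I₁)
    (λ { refl → I₁ })
  where
  s₁ = withAdj s (addE (adj s) u v)
  I₁ = withAdj-invariant s _ (insert-loopless (adj s) u v u≢v (loopless I)) I

-- The invariant holds after every valid sequence of updates.  (If a step
-- fails, so does the run, and that case is absurd.)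
run-invariant : ∀ {n Δ} o fuel {g} (s : State n Δ) {us s'} → Valid Δ g us → Invariant s 0 →
  run o fuel s us ≡ just s' → Invariant s' 0
run-invariant o fuel s done I refl = I
run-invariant o fuel s (vins {u = u} {v} u≢v _ _ valid) I eq with step o fuel s (ins u v) in step-eq
... | just s₁ = run-invariant o fuel s₁ valid (insert-invariant o fuel s u v u≢v I step-eq) eq
run-invariant o fuel s (vdel {u = u} {v} _ valid) I eq =
  run-invariant o fuel (withAdj s (delE (adj s) u v)) valid
    (withAdj-invariant s _ (delete-loopless (adj s) u v (loopless I)) I) eq

initial-invariant : ∀ {n Δ} (c0 : Fin n → Fin (suc Δ)) → Invariant (initState c0) 0
initial-invariant c0 = record { loopless = λ _ → refl ; current = λ _ → none ; costs = [] ; paid = z≤n }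

third-bound : ∀ w c → 3 * w ≤ 2 * (w + c) → w ≤ 2 * c
third-bound w c h = +-cancelˡ-≤ (2 * w) w (2 * c) (begin
  2 * w + w     ≡⟨ +-comm (2 * w) w ⟩
  3 * w         ≤⟨ h ⟩
  2 * (w + c)   ≡⟨ *-distribˡ-+ 2 w c ⟩
  2 * w + 2 * c ∎)
  where open ≤-Reasoning

levelWeight inducedLevelWeight : ∀ {n} → List (Epoch n) → (ℕ → Bool) → ℕ
levelWeight        es H = sumWhere (H ∘ lvl) weight es
inducedLevelWeight es H = sumWhere (λ e → H (lvl e) ∧ isInduced e) weight es

HalfInduced : ∀ {n} → List (Epoch n) → (ℕ → Bool) → Set
HalfInduced es H = ∀ m → T (H m) → countE (atLevel m) es ≤ 2 * countE (λ e → atLevel m e ∧ isInduced e) es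

half-induced-weight : ∀ {n} (es : List (Epoch n)) H → HalfInduced es H →
  levelWeight es H ≤ 2 * inducedLevelWeight es H
half-induced-weight es H half-induced =
  ByLevel.levelwise-bound lvl (3 ^_) 2 (H ∘ lvl) (λ e → H (lvl e) ∧ isInduced e) es λ m →
    subst₂ (λ a b → a ≤ 2 * b)
      (count-cong es λ e → sym (≡ᵇ-subst H (lvl e) m))
      (count-cong es λ e → sym (≡ᵇ-subst (λ l → H l ∧ isInduced e) (lvl e) m))
      (at-level m (H m) (half-induced m))
  where
  at-level : ∀ m b → (T b → countE (atLevel m) es ≤ 2 * countE (λ e → atLevel m e ∧ isInduced e) es) →
    count (λ e → (lvl e ≡ᵇ m) ∧ b) es ≤ 2 * count (λ e → (lvl e ≡ᵇ m) ∧ (b ∧ isInduced e)) es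
  at-level m true  h = subst (_≤ 2 * countE (λ e → atLevel m e ∧ isInduced e) es)
                             (count-cong es λ e → sym (∧-identityʳ _)) (h _)
  at-level m false _ = m≤n*m _ 2

induced-weight≤charge : ∀ {n} (es : List (Epoch n)) H → 3 * inducedLevelWeight es H ≤ inducedCharge es
induced-weight≤charge es H = begin
  3 * inducedLevelWeight es H         ≡⟨ sumWhere-scale Hι 3 weight es ⟨
  sumWhere Hι (λ e → 3 * weight e) es ≤⟨ sumWhere-monoˡ _ es (λ e → proj₂ ∘ Equivalence.to T-∧) ⟩
  inducedCharge es                    ∎
  where
  open ≤-Reasoning
  Hι : Epoch _ → Bool
  Hι e = H (lvl e) ∧ isInduced e

cost≤2levelWeight : ∀ {n} (es : List (Epoch n)) H → All CostBounds es → costOfLevels es H ≤ 2 * levelWeight es H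
cost≤2levelWeight es H bounds = begin
  costOfLevels es H                          ≤⟨ sumWhere-monoʳ cost (λ e → 2 * weight e) es
                                                  (All.map (λ b _ → cost≤2weight b) bounds) ⟩
  sumWhere (H ∘ lvl) (λ e → 2 * weight e) es ≡⟨ sumWhere-scale (H ∘ lvl) 2 weight es ⟩
  2 * levelWeight es H                       ∎
  where open ≤-Reasoning

-- The credit is at most the weight of the levels in H plus the cost of the
-- other levels, since an epoch started by rand-color costs at least its weight.
credit≤weight+cost : ∀ {n} (es : List (Epoch n)) H → All CostBounds es →
  randCredit es ≤ levelWeight es H + costOfLevels es (not ∘ H)
credit≤weight+cost es H bounds = begin
  randCredit es ≡⟨ sumWhere-split (λ e → 1 ≤ᵇ lvl e) (H ∘ lvl) weight es ⟩
  sumWhere (λ e → (1 ≤ᵇ lvl e) ∧ H (lvl e)) weight es + sumWhere rand∉H weight es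
    ≤⟨ +-mono-≤ (sumWhere-monoˡ weight es λ e → proj₂ ∘ Equivalence.to T-∧) (begin
        sumWhere rand∉H weight es ≤⟨ sumWhere-monoʳ weight cost es (All.map weight≤cost′ bounds) ⟩
        sumWhere rand∉H cost es   ≤⟨ sumWhere-monoˡ cost es (λ e → proj₂ ∘ Equivalence.to T-∧) ⟩
        costOfLevels es (not ∘ H) ∎) ⟩
  levelWeight es H + costOfLevels es (not ∘ H) ∎
  where
  open ≤-Reasoning
  rand∉H : Epoch _ → Bool
  rand∉H e = (1 ≤ᵇ lvl e) ∧ not (H (lvl e))
  weight≤cost′ : ∀ {e} → CostBounds e → T (rand∉H e) → weight e ≤ cost e
  weight≤cost′ {e} b h = weight≤cost b (≤ᵇ⇒≤ 1 (lvl e) (proj₁ (Equivalence.to T-∧ h)))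

heavy-levels-bound : ∀ {n} (es : List (Epoch n)) (H : ℕ → Bool) → HalfInduced es H →
  All CostBounds es → inducedCharge es ≤ randCredit es →
  costOfLevels es H ≤ 4 * costOfLevels es (not ∘ H)
heavy-levels-bound es H half-induced bounds paid = begin
  costOfLevels es H ≤⟨ cost≤2levelWeight es H bounds ⟩
  2 * W             ≤⟨ *-monoʳ-≤ 2 (third-bound W N 3W≤2[W+N]) ⟩
  2 * (2 * N)       ≡⟨ *-assoc 2 2 N ⟨
  4 * N             ∎
  where
  open ≤-Reasoning
  W Wι N : ℕ
  W  = levelWeight es H
  Wι = inducedLevelWeight es H
  N  = costOfLevels es (not ∘ H)
  3Wι≤W+N : 3 * Wι ≤ W + N
  3Wι≤W+N = ≤-trans (induced-weight≤charge es H) (≤-trans paid (credit≤weight+cost es H bounds))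
  3W≤2[W+N] : 3 * W ≤ 2 * (W + N)
  3W≤2[W+N] = begin
    3 * W        ≤⟨ *-monoʳ-≤ 3 (half-induced-weight es H half-induced) ⟩
    3 * (2 * Wι) ≡⟨ *-exchange 3 2 Wι ⟩
    2 * (3 * Wι) ≤⟨ *-monoʳ-≤ 2 3Wι≤W+N ⟩
    2 * (W + N)  ∎

not-induced-heavy : ∀ {n} (es : List (Epoch n)) m →
  not (inducedHeavy es m) ≡ (originalHeavy es m ∨ finalHeavy es m)
not-induced-heavy es m = cases (inducedHeavy es m) _
  where
  cases : ∀ a b → not a ≡ (not a ∧ not (not a ∧ b)) ∨ (not a ∧ b)
  cases true  _     = refl
  cases false true  = refl
  cases false false = refl

-- The invariant holds at the end of the run, and induced-heavy levels have
-- at least half of their epochs induced; so C = 4 works.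
lemma6 : ∃[ C ] ∀ (n Δ : ℕ) → 1 ≤ Δ → (us : List (Update n)) → Valid Δ emptyG us →
           (c0 : Fin n → Fin (suc Δ)) → (o : Oracle) → (fuel : ℕ) → (s : State n Δ) →
           run o fuel (initState c0) us ≡ just s →
           costOfLevels (epochs s) (inducedHeavy (epochs s))
             ≤ C * costOfLevels (epochs s) (λ m → originalHeavy (epochs s) m ∨ finalHeavy (epochs s) m)
lemma6 = 4 , λ n Δ _ us valid c0 o fuel s run≡s →
  let I  = run-invariant o fuel (initState c0) valid (initial-invariant c0) run≡s
      es = epochs s
  in subst (λ N → costOfLevels es (inducedHeavy es) ≤ 4 * N)
       (sumWhere-cong cost es (All.universal (λ e → not-induced-heavy es (lvl e)) es))
       (heavy-levels-bound es (inducedHeavy es) (λ m → ≤ᵇ⇒≤ _ _) (costs I)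
         (subst (_≤ randCredit es) (+-identityʳ _) (paid I)))
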